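{- There is no $48\times 13$ binary $5$-covering array.
   Context: A binary $t$-covering array of size $m$ and degree $n$ is an $m\times n$ matrix with entries in $\{0,1\}$ such that for any $t$ distinct columns, all $2^t$ binary vectors of length $t$ occur at least once as the restriction of some row to those columns. -}

module Defs where

open import Data.Nat using (ℕ)
open import Data.Fin using (Fin)
open import Data.Bool using (Bool)
open import Data.Product using (Σ; ∃)
open import Relation.Binary.PropositionalEquality using (_≡_)
open import Function.Definitions using (Injective)

Matrix : ℕ → ℕ → Set
Matrix m n = Fin m → Fin n → Bool

IsCoveringArray : (t m n : ℕ) → Matrix m n → Set
IsCoveringArray t m n A =
  (c : Fin t → Fin n) → Injective _≡_ _≡_ c →
  (v : Fin t → Bool) →
  ∃ λ (r : Fin m) → (i : Fin t) → A r (c i) ≡ v i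

module Submission where

-- Fixing a value pattern on at most three columns, the number of rows
-- showing it is exact: every distinct 5-pattern is matched, so every 4-pattern is matched at
-- least twice (split on a fresh column) and every 3-pattern at least six times (the matching
-- rows, read on five fresh columns, form a binary 2-covering array, and none has five rows);
-- as 48 = 8 · 6 these bounds are attained, giving 6, 12, 24 rows for 3, 2, 1 columns.
-- On four distinct columns the sixteen counts lie in {2, 3, 4}; the block is balanced when
-- they all equal 3, and two blocks sharing three columns are never both unbalanced.
--
-- The contradiction comes from the moments of the agreement numbers g(r, r') (the number
-- of columns on which rows r, r' agree): the t-th moment over all ordered pairs of rows is
-- the sum, over t-tuples of columns, of the number of pairs agreeing on the tuple. The
-- moments of order ≤ 3 are thus known exactly, and the fourth is bounded via the packing of
-- unbalanced blocks. Summing the inequality (g² − 12g + 33)² ≥ 0, which has slack 46² on the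
-- 48 diagonal pairs (g = 13), over all pairs of rows then fails numerically.

open import Defs
open import Data.Nat using (ℕ; zero; suc; _+_; _*_; _^_; _≡ᵇ_; _≤_; _<_; z≤n; s≤s)
open import Data.Nat.Properties
open import Data.Nat.Tactic.RingSolver using (solve-∀)
open import Algebra.Properties.CommutativeSemigroup +-commutativeSemigroup using (interchange)
open import Data.Bool using (Bool; true; false; _∧_; _∨_; _xor_; not; T)
open import Data.Bool.Properties using (∧-assoc; T-≡; T-∧; T-∨; T?)
open import Data.Bool.ListAction using (all; or)
open import Data.Fin using (Fin; zero; suc)
import Data.Fin as Fin
open import Data.Fin.Properties using (all?; ¬∀⟶∃¬; <⇒notInjective)
open import Data.List using (List; []; _∷_; _++_; length; map; zipWith; tabulate; lookup; allFin; filter; filterᵇ; cartesianProductWith; cartesianProduct; deduplicate)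
open import Data.List.Properties using (length-map; length-++; length-tabulate; length-filter; filter-complete; map-++; length-++-sucʳ; ++-assoc; ∷-injective)
open import Data.List.Membership.Propositional using (_∈_; _∉_; lose)
open import Data.List.Membership.Propositional.Properties using (∈-cartesianProductWith⁻; ∈-++⁻; ∈-map⁻; ∈-cartesianProductWith⁺; ∈-allFin; ∈-map⁺; ∈-lookup; ∈-filter⁺)
import Data.List.Membership.Setoid.Properties as SetoidMembership
open import Data.List.Relation.Unary.Any using (Any; here; there)
import Data.List.Relation.Unary.Any.Properties as AnyP
open import Data.List.Relation.Unary.All as All using (All; []; _∷_)
open import Data.List.Relation.Unary.All.Properties as AllP using (all⁺; all⁻; ¬Any⇒All¬)
open import Data.List.Relation.Unary.AllPairs using (AllPairs; []; _∷_)
import Data.List.Relation.Unary.AllPairs.Properties as AllPairs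
open import Data.List.Relation.Unary.Unique.Propositional using (Unique)
open import Data.List.Relation.Unary.Unique.Propositional.Properties using (allFin⁺)
open import Data.Product using (Σ; ∃; _×_; _,_; proj₁; proj₂)
open import Data.Sum using (_⊎_; inj₁; inj₂)
open import Data.Empty using (⊥; ⊥-elim)
open import Data.Unit using (tt)
open import Function using (_∘_)
open import Function.Bundles using (Equivalence; _⇔_; mk⇔)
open import Function.Definitions using (Injective)
open import Relation.Nullary using (¬_; ¬?; Dec; yes; no; contradiction)
open import Relation.Nullary.Decidable using (isYes; toWitness; fromWitness)
open import Relation.Binary.Definitions using (DecidableEquality)
open import Relation.Binary.PropositionalEquality

infix 5 ∑
∑ : {X : Set} → List X → (X → ℕ) → ℕ
∑ [] f = 0
∑ (x ∷ xs) f = f x + ∑ xs f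

syntax ∑ xs (λ x → e) = ∑[ x ∈ xs ] e

private variable X Y P : Set

∑-cong : ∀ (xs : List X) {f g : X → ℕ} → (∀ {x} → x ∈ xs → f x ≡ g x) → ∑ xs f ≡ ∑ xs g
∑-cong [] eq = refl
∑-cong (x ∷ xs) eq = cong₂ _+_ (eq (here refl)) (∑-cong xs (eq ∘ there))

∑-mono : ∀ (xs : List X) {f g : X → ℕ} → (∀ {x} → x ∈ xs → f x ≤ g x) → ∑ xs f ≤ ∑ xs g
∑-mono [] le = z≤n
∑-mono (x ∷ xs) le = +-mono-≤ (le (here refl)) (∑-mono xs (le ∘ there))

term≤∑ : ∀ {xs : List X} (f : X → ℕ) {x} → x ∈ xs → f x ≤ ∑ xs f
term≤∑ {xs = y ∷ xs} f (here refl) = m≤m+n (f y) (∑ xs f)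
term≤∑ {xs = y ∷ xs} f (there x∈) = ≤-trans (term≤∑ f x∈) (m≤n+m (∑ xs f) (f y))

∑-const : ∀ (xs : List X) c → ∑[ x ∈ xs ] c ≡ length xs * c
∑-const [] c = refl
∑-const (x ∷ xs) c = cong (c +_) (∑-const xs c)

∑-+ : ∀ (xs : List X) (f g : X → ℕ) → ∑[ x ∈ xs ] (f x + g x) ≡ ∑ xs f + ∑ xs g
∑-+ [] f g = refl
∑-+ (x ∷ xs) f g = trans (cong (f x + g x +_) (∑-+ xs f g)) (interchange (f x) (g x) (∑ xs f) (∑ xs g))

∑-*ˡ : ∀ (xs : List X) c (f : X → ℕ) → ∑[ x ∈ xs ] (c * f x) ≡ c * ∑ xs f
∑-*ˡ [] c f = sym (*-zeroʳ c)
∑-*ˡ (x ∷ xs) c f = trans (cong (c * f x +_) (∑-*ˡ xs c f)) (sym (*-distribˡ-+ c (f x) (∑ xs f)))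

∑-*ʳ : ∀ (xs : List X) c (f : X → ℕ) → ∑[ x ∈ xs ] (f x * c) ≡ ∑ xs f * c
∑-*ʳ xs c f = trans (∑-cong xs (λ {x} _ → *-comm (f x) c)) (trans (∑-*ˡ xs c f) (*-comm c (∑ xs f)))

∑-++ : ∀ (xs ys : List X) (f : X → ℕ) → ∑ (xs ++ ys) f ≡ ∑ xs f + ∑ ys f
∑-++ [] ys f = refl
∑-++ (x ∷ xs) ys f = trans (cong (f x +_) (∑-++ xs ys f)) (sym (+-assoc (f x) (∑ xs f) (∑ ys f)))

∑-0 : ∀ (xs : List X) → ∑[ x ∈ xs ] 0 ≡ 0
∑-0 xs = trans (∑-const xs 0) (*-zeroʳ (length xs))

∑-map : ∀ (g : X → Y) (xs : List X) (f : Y → ℕ) → ∑ (map g xs) f ≡ ∑[ x ∈ xs ] f (g x)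
∑-map g [] f = refl
∑-map g (x ∷ xs) f = cong (f (g x) +_) (∑-map g xs f)

∑-cartesianProductWith : ∀ {Z : Set} (g : X → Y → Z) (xs : List X) (ys : List Y) (f : Z → ℕ) →
  ∑ (cartesianProductWith g xs ys) f ≡ ∑[ x ∈ xs ] ∑[ y ∈ ys ] f (g x y)
∑-cartesianProductWith g [] ys f = refl
∑-cartesianProductWith g (x ∷ xs) ys f =
  trans (∑-++ (map (g x) ys) _ f) (cong₂ _+_ (∑-map (g x) ys f) (∑-cartesianProductWith g xs ys f))

∑-linear : ∀ (xs : List X) a b c (f g h : X → ℕ) →
  ∑[ x ∈ xs ] (a * f x + b * g x + c * h x) ≡ a * ∑ xs f + b * ∑ xs g + c * ∑ xs h
∑-linear xs a b c f g h = trans (∑-+ xs _ _) (cong₂ _+_ (trans (∑-+ xs _ _) (cong₂ _+_ (∑-*ˡ xs a f) (∑-*ˡ xs b g))) (∑-*ˡ xs c h))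

∑-allFin : ∀ k → ∑[ x ∈ allFin k ] 1 ≡ k
∑-allFin k = trans (∑-const (allFin k) 1) (trans (*-identityʳ _) (length-tabulate (λ x → x)))

∑-swap : ∀ (xs : List X) (ys : List Y) (f : X → Y → ℕ) →
         ∑[ x ∈ xs ] ∑[ y ∈ ys ] f x y ≡ ∑[ y ∈ ys ] ∑[ x ∈ xs ] f x y
∑-swap [] ys f = sym (∑-0 ys)
∑-swap (x ∷ xs) ys f = trans (cong (∑ ys (f x) +_) (∑-swap xs ys f)) (sym (∑-+ ys (f x) (λ y → ∑[ x ∈ xs ] f x y)))

∑-atMostOne : ∀ {xs : List X} → Unique xs → (f : X → ℕ) → (∀ x → f x ≤ 1) →
              (∀ {x y} → ¬ x ≡ y → 1 ≤ f x → f y ≡ 0) → ∑ xs f ≤ 1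
∑-atMostOne {xs = []} _ f ≤1 excl = z≤n
∑-atMostOne {xs = x ∷ xs} (x∉xs ∷ u) f ≤1 excl with f x in fx | ≤1 x
... | zero | _ = ∑-atMostOne u f ≤1 excl
... | suc (suc _) | s≤s ()
... | suc zero | _ = ≤-reflexive (cong suc rest≡0)
  where
  rest≡0 : ∑ xs f ≡ 0
  rest≡0 = trans (∑-cong xs (λ y∈xs → excl (All.lookup x∉xs y∈xs) (≤-reflexive (sym fx)))) (∑-0 xs)

⟦_⟧ : Bool → ℕ
⟦ true ⟧ = 1
⟦ false ⟧ = 0

is : Bool → Bool → Bool
is true x = x
is false x = not x

is-refl : ∀ x → T (is x x)
is-refl true = tt
is-refl false = tt

is-sound : ∀ {u x} → T (is u x) → x ≡ u
is-sound {true} {true} _ = refl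
is-sound {false} {false} _ = refl

⟦∧⟧ : ∀ x y → ⟦ x ∧ y ⟧ ≡ ⟦ x ⟧ * ⟦ y ⟧
⟦∧⟧ true y = sym (+-identityʳ ⟦ y ⟧)
⟦∧⟧ false y = refl

T-ext : ∀ {x y} → (T x → T y) → (T y → T x) → x ≡ y
T-ext {true} {true} _ _ = refl
T-ext {true} {false} to _ = ⊥-elim (to tt)
T-ext {false} {true} _ from = ⊥-elim (from tt)
T-ext {false} {false} _ _ = refl

split₃ : ∀ {x y z} → T (x ∧ (y ∧ z)) → T x × T y × T z
split₃ {true} {true} t = tt , tt , t

⟦T⟧ : ∀ {b} → T b → ⟦ b ⟧ ≡ 1
⟦T⟧ {true} _ = refl

⟦⟧≤1 : ∀ b → ⟦ b ⟧ ≤ 1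
⟦⟧≤1 true = ≤-refl
⟦⟧≤1 false = z≤n

⟦⟧≥1 : ∀ {b} → 1 ≤ ⟦ b ⟧ → T b
⟦⟧≥1 {true} _ = tt

≤1-not-≥1 : ∀ {x} → x ≤ 1 → ¬ 1 ≤ x → x ≡ 0
≤1-not-≥1 {zero} _ _ = refl
≤1-not-≥1 {suc zero} _ ¬1≤1 = ⊥-elim (¬1≤1 ≤-refl)
≤1-not-≥1 {suc (suc _)} (s≤s ()) _

T-not : ∀ {b} → T (not b) → ¬ T b
T-not {false} _ ()

T-∨ˡ : ∀ {x y} → T x → T (x ∨ y)
T-∨ˡ t = Equivalence.from T-∨ (inj₁ t)

T-∨ʳ : ∀ {x y} → T y → T (x ∨ y)
T-∨ʳ t = Equivalence.from T-∨ (inj₂ t)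

module _ {X : Set} (_≟_ : DecidableEquality X) where

  length-deduplicate : ∀ xs → length (deduplicate _≟_ xs) ≤ length xs
  length-deduplicate [] = z≤n
  length-deduplicate (x ∷ xs) = s≤s (≤-trans (length-filter (¬? ∘ (x ≟_)) (deduplicate _≟_ xs)) (length-deduplicate xs))

  deduplicate-complete : ∀ xs → length (deduplicate _≟_ xs) ≡ length xs → deduplicate _≟_ xs ≡ xs
  deduplicate-complete [] _ = refl
  deduplicate-complete (x ∷ xs) eq = cong (x ∷_) (trans (filter-complete (¬? ∘ (x ≟_)) filtered≡) (deduplicate-complete xs deduped≡))
    where
    filtered≤ : length (filter (¬? ∘ (x ≟_)) (deduplicate _≟_ xs)) ≤ length (deduplicate _≟_ xs)
    filtered≤ = length-filter (¬? ∘ (x ≟_)) (deduplicate _≟_ xs)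
    deduped≡ : length (deduplicate _≟_ xs) ≡ length xs
    deduped≡ = ≤-antisym (length-deduplicate xs) (≤-trans (≤-reflexive (sym (suc-injective eq))) filtered≤)
    filtered≡ : length (filter (¬? ∘ (x ≟_)) (deduplicate _≟_ xs)) ≡ length (deduplicate _≟_ xs)
    filtered≡ = trans (suc-injective eq) (sym deduped≡)

All-remove : ∀ {P : X → Set} xs {y} ys → All P (xs ++ y ∷ ys) → All P (xs ++ ys)
All-remove [] ys (_ ∷ pys) = pys
All-remove (x ∷ xs) ys (px ∷ pxs) = px ∷ All-remove xs ys pxs

Unique-remove : ∀ (xs : List X) {y} ys → Unique (xs ++ y ∷ ys) → Unique (xs ++ ys)
Unique-remove [] ys (_ ∷ u) = u
Unique-remove (x ∷ xs) ys (x∉ ∷ u) = All-remove xs ys x∉ ∷ Unique-remove xs ys u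

square-bound : ∀ x f → 2 ≤ x → x ≤ 4 → (f ≡ 0 → x ≡ 3) → x * x + 9 ≤ 6 * x + f
square-bound x zero _ _ x≡3 rewrite x≡3 refl = ≤-refl
square-bound x (suc f) 2≤x x≤4 _ = ≤-trans (bound x 2≤x x≤4) (+-monoʳ-≤ (6 * x) (s≤s z≤n))
  where
  bound : ∀ x → 2 ≤ x → x ≤ 4 → x * x + 9 ≤ 6 * x + 1
  bound 1 (s≤s ()) _
  bound 2 _ _ = ≤-refl
  bound 3 _ _ = n≤1+n 18
  bound 4 _ _ = ≤-refl
  bound (suc (suc (suc (suc (suc _))))) _ (s≤s (s≤s (s≤s (s≤s ()))))

four-and-two : ∀ x y → x + y ≡ 6 → 2 ≤ x → 2 ≤ y → ¬ y ≡ 3 → (x ≡ 4 × y ≡ 2) ⊎ (x ≡ 2 × y ≡ 4)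
four-and-two x 1 _ _ (s≤s ()) _
four-and-two x 2 sum _ _ _ = inj₁ (+-cancelʳ-≡ 2 x 4 sum , refl)
four-and-two x 3 _ _ _ y≢3 = ⊥-elim (y≢3 refl)
four-and-two x 4 sum _ _ _ = inj₂ (+-cancelʳ-≡ 4 x 2 sum , refl)
four-and-two x (suc (suc (suc (suc (suc y))))) sum 2≤x _ _ =
  ⊥-elim (<⇒≢ (+-mono-≤ 2≤x (s≤s (s≤s (s≤s (s≤s (s≤s z≤n)))))) (sym sum))

complement-3 : ∀ {x y} → x + y ≡ 6 → x ≡ 3 → y ≡ 3
complement-3 {y = y} sum refl = +-cancelˡ-≡ 3 y 3 sum

choose : ∀ (f : Bool → ℕ) → (f true ≡ 4 × f false ≡ 2) ⊎ (f true ≡ 2 × f false ≡ 4) → ∃ λ u → f u ≡ 4 × f (not u) ≡ 2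
choose f (inj₁ (four , two)) = true , four , two
choose f (inj₂ (two , four)) = false , four , two

same-complement : ∀ {x y z} → x + y ≡ 6 → y + z ≡ 6 → x ≡ z
same-complement {x} {y} {z} sum₁ sum₂ = +-cancelʳ-≡ y x z (trans sum₁ (trans (sym sum₂) (+-comm y z)))

slice-bound : ∀ n₁ n₂ n₃ → n₁ + n₂ ≡ 4 → n₂ + n₃ ≡ 2 → 1 ≤ n₃ → 3 ≤ n₁
slice-bound n₁ n₂ n₃ sum₁ sum₂ 1≤n₃ = +-cancelʳ-≤ n₂ 3 n₁ (≤-trans (+-monoʳ-≤ 3 n₂≤1) (≤-reflexive (sym sum₁)))
  where
  n₂≤1 : n₂ ≤ 1
  n₂≤1 = +-cancelʳ-≤ n₃ n₂ 1 (≤-trans (≤-reflexive sum₂) (+-monoʳ-≤ 1 1≤n₃))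

twice-product≤squares : ∀ a b → 2 * (a * b) ≤ a * a + b * b
twice-product≤squares a b with ≤-total a b
... | inj₁ a≤b with m≤n⇒∃[o]m+o≡n a≤b
...   | d , refl = subst (2 * (a * (a + d)) ≤_) (identity a d) (m≤m+n _ (d * d))
  where
  identity : ∀ a d → 2 * (a * (a + d)) + d * d ≡ a * a + (a + d) * (a + d)
  identity = solve-∀
twice-product≤squares a b | inj₂ b≤a with m≤n⇒∃[o]m+o≡n b≤a
...   | d , refl = subst (2 * ((b + d) * b) ≤_) (identity b d) (m≤m+n _ (d * d))
  where
  identity : ∀ b d → 2 * ((b + d) * b) + d * d ≡ (b + d) * (b + d) + b * b
  identity = solve-∀

-- The polynomial (x² − 12x + 33)² is nonnegative: 24x³ + 792x ≤ x⁴ + 210x² + 1089, written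
-- with the powers of x that will become moments.  It is 2ab ≤ a² + b² for a = x² + 33, b = 12x.
quartic-bound : ∀ x → 24 * x ^ 3 + 792 * x ^ 1 ≤ 1 * x ^ 4 + 210 * x ^ 2 + 1089 * x ^ 0
quartic-bound x = subst₂ _≤_ (lhs x) (rhs x) (twice-product≤squares (x * x + 33) (12 * x))
  where
  lhs : ∀ x → 2 * ((x * x + 33) * (12 * x)) ≡ 24 * (x * (x * (x * 1))) + 792 * (x * 1)
  lhs = solve-∀
  rhs : ∀ x → (x * x + 33) * (x * x + 33) + 12 * x * (12 * x) ≡ 1 * (x * (x * (x * (x * 1)))) + 210 * (x * (x * 1)) + 1089 * 1
  rhs = solve-∀

-- `cliqueFree adj V k S` decides, by exhaustive search adding one candidate at a time,
-- that no k elements of V are pairwise adjacent and adjacent to every element of S.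
cliqueFree : (P → P → Bool) → List P → ℕ → List P → Bool
cliqueFree adj V zero S = false
cliqueFree adj V (suc k) S = all (λ v → not (all (adj v) S) ∨ cliqueFree adj V k (v ∷ S)) V

cliqueFree-sound : ∀ (adj : P → P → Bool) V k S → T (cliqueFree adj V k S) →
  (C : List P) → length C ≡ k → All (_∈ V) C → AllPairs (λ x y → T (adj y x)) C →
  All (λ c → T (all (adj c) S)) C → ⊥
cliqueFree-sound adj V (suc k) S free (c ∷ C) refl (c∈V ∷ C⊆V) (c~C ∷ clique) (c~S ∷ C~S) =
  cliqueFree-sound adj V k (c ∷ S) (step (All.lookup (all⁺ _ V free) c∈V) c~S) C refl C⊆V clique
    (All.zipWith (λ (x~c , x~S) → all⁻ (adj _) (x~c ∷ all⁺ (adj _) S x~S)) (c~C , C~S))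
  where
  step : ∀ {a b} → T (not a ∨ b) → T a → T b
  step {true} b _ = b

words : ℕ → List (List Bool)
words zero = [] ∷ []
words (suc k) = cartesianProductWith _∷_ (true ∷ false ∷ []) (words k)

∈-words : ∀ (s : List Bool) → s ∈ words (length s)
∈-words [] = here refl
∈-words (true ∷ s) = ∈-cartesianProductWith⁺ _∷_ {xs = true ∷ false ∷ []} (here refl) (∈-words s)
∈-words (false ∷ s) = ∈-cartesianProductWith⁺ _∷_ {xs = true ∷ false ∷ []} (there (here refl)) (∈-words s)

TwoCovering : ∀ {k} → List (Fin k → Bool) → Set
TwoCovering {k} Ws = ∀ {a b : Fin k} → ¬ a ≡ b → ∀ u v → Any (λ w → w a ≡ u × w b ≡ v) Ws

shows : Bool → Bool → List Bool → List Bool → Bool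
shows u v s t = or (zipWith (λ x y → is u x ∧ is v y) s t)

-- Two columns relative to the first row of a 2-covering array must show (1,1), (1,0)
-- and (0,1) among the remaining rows; (0,0) is already shown by the first row.
compatible : List Bool → List Bool → Bool
compatible s t = shows true true s t ∧ (shows true false s t ∧ shows false true s t)

relProfile : ∀ {k} → (Fin k → Bool) → List (Fin k → Bool) → Fin k → List Bool
relProfile w₁ Ws a = map (λ w → w a xor w₁ a) Ws

xor-cancel : ∀ p c → (p xor c) xor c ≡ p
xor-cancel true true = refl
xor-cancel true false = refl
xor-cancel false true = refl
xor-cancel false false = refl

xor-fixed : ∀ {u c} → c ≡ u xor c → u ≡ false
xor-fixed {false} _ = refl
xor-fixed {true} {true} ()
xor-fixed {true} {false} ()

shows-relProfile : ∀ {k} {w₁} {Ws : List (Fin k → Bool)} {a b u v} →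
  Any (λ w → w a ≡ u xor w₁ a × w b ≡ v xor w₁ b) Ws → T (shows u v (relProfile w₁ Ws a) (relProfile w₁ Ws b))
shows-relProfile {w₁ = w₁} {a = a} {b} {u} {v} (here {x = w} (wa , wb)) =
  T-∨ˡ {is u (w a xor w₁ a) ∧ is v (w b xor w₁ b)} (Equivalence.from T-∧ (is-xor {c = w₁ a} {u} wa , is-xor {c = w₁ b} {v} wb))
  where
  is-xor : ∀ {x c p} → x ≡ p xor c → T (is p (x xor c))
  is-xor {c = c} {p} refl = subst (T ∘ is p) (sym (xor-cancel p c)) (is-refl p)
shows-relProfile {w₁ = w₁} {a = a} {b} {u} {v} (there {x = w} any) =
  T-∨ʳ {is u (w a xor w₁ a) ∧ is v (w b xor w₁ b)} (shows-relProfile {w₁ = w₁} {a = a} {b} {u} {v} any)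

compatible-relProfile : ∀ {k} {w₁} {Ws : List (Fin k → Bool)} → TwoCovering (w₁ ∷ Ws) →
  ∀ {a b} → ¬ a ≡ b → T (compatible (relProfile w₁ Ws a) (relProfile w₁ Ws b))
compatible-relProfile {w₁ = w₁} {Ws} cov {a} {b} a≢b =
  Equivalence.from T-∧ (showsPair true true (λ ()) , Equivalence.from T-∧ (showsPair true false (λ ()) , showsPair false true (λ ())))
  where
  showsPair : ∀ u v → ¬ (u ≡ false × v ≡ false) → T (shows u v (relProfile w₁ Ws a) (relProfile w₁ Ws b))
  showsPair u v notOrigin with cov a≢b (u xor w₁ a) (v xor w₁ b)
  ... | here (wa , wb) = ⊥-elim (notOrigin (xor-fixed wa , xor-fixed wb))
  ... | there any = shows-relProfile {w₁ = w₁} {a = a} {b} {u} {v} any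

cliqueFree-words : ∀ k → k ≤ 4 → T (cliqueFree compatible (words k) 5 [])
cliqueFree-words 0 _ = tt
cliqueFree-words 1 _ = tt
cliqueFree-words 2 _ = tt
cliqueFree-words 3 _ = tt
cliqueFree-words 4 _ = tt
cliqueFree-words (suc (suc (suc (suc (suc _))))) (s≤s (s≤s (s≤s (s≤s ()))))

noSmallTwoCovering : (Ws : List (Fin 5 → Bool)) → length Ws ≤ 5 → ¬ TwoCovering Ws
noSmallTwoCovering [] _ cov with cov {zero} {suc zero} (λ ()) true true
... | ()
noSmallTwoCovering (w₁ ∷ Ws) (s≤s len≤4) cov =
  cliqueFree-sound compatible (words (length Ws)) 5 [] (cliqueFree-words (length Ws) len≤4)
    (tabulate profile) refl (AllP.tabulate⁺ {f = profile} (λ a → subst (λ n → profile a ∈ words n) (length-map _ Ws) (∈-words (profile a))))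
    (AllPairs.tabulate⁺ {f = profile} (λ a≢b → compatible-relProfile cov (λ b≡a → a≢b (sym b≡a)))) (AllP.tabulate⁺ {f = profile} (λ _ → tt))
  where
  profile : Fin 5 → List Bool
  profile = relProfile w₁ Ws

-- A list of fewer than n columns misses some column: otherwise the positions of the
-- columns in the list would inject Fin n into a smaller Fin.
module _ {n : ℕ} where
  open import Data.List.Membership.DecPropositional (Fin._≟_ {n}) using (_∈?_)

  fresh : (L : List (Fin n)) → length L < n → ∃ λ c → c ∉ L
  fresh L len<n with all? (_∈? L)
  ... | yes all∈L = contradiction (λ {c} {c'} → SetoidMembership.index-injective (setoid (Fin n)) (all∈L c) (all∈L c')) (<⇒notInjective len<n)
  ... | no ¬all∈L = ¬∀⟶∃¬ n (_∈ L) (_∈? L) ¬all∈L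

freshColumns : ∀ {n} k (L : List (Fin n)) → length L + k ≤ n →
               Σ (Fin k → Fin n) λ e → Injective _≡_ _≡_ e × (∀ a → e a ∉ L)
freshColumns zero L _ = (λ ()) , (λ { {()} }) , λ ()
freshColumns {n} (suc k) L room with fresh L (≤-trans (s≤s (m≤m+n (length L) k)) (≤-trans (≤-reflexive (sym (+-suc (length L) k))) room))
... | c , c∉L with freshColumns k (c ∷ L) (≤-trans (≤-reflexive (sym (+-suc (length L) k))) room)
... | e , e-inj , e∉ = extend , extend-inj , extend∉
  where
  extend : Fin (suc k) → Fin n
  extend zero = c
  extend (suc a) = e a
  extend-inj : Injective _≡_ _≡_ extend
  extend-inj {zero} {zero} _ = refl
  extend-inj {zero} {suc b} c≡eb = ⊥-elim (e∉ b (here (sym c≡eb)))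
  extend-inj {suc a} {zero} ea≡c = ⊥-elim (e∉ a (here ea≡c))
  extend-inj {suc a} {suc b} ea≡eb = cong suc (e-inj ea≡eb)
  extend∉ : ∀ a → extend a ∉ L
  extend∉ zero = c∉L
  extend∉ (suc a) = e∉ a ∘ there

Pattern : ℕ → Set
Pattern n = List (Fin n × Bool)

columns : ∀ {n} → Pattern n → List (Fin n)
columns = map proj₁

Distinct : ∀ {n} → Pattern n → Set
Distinct p = Unique (columns p)

columns-++ : ∀ {n} (xs : Pattern n) c b b' ys → columns (xs ++ (c , b) ∷ ys) ≡ columns (xs ++ (c , b') ∷ ys)
columns-++ [] c b b' ys = refl
columns-++ (x ∷ xs) c b b' ys = cong (proj₁ x ∷_) (columns-++ xs c b b' ys)

columns-label : ∀ {n} (f : Fin n → Bool) L → columns (map (λ c → c , f c) L) ≡ L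
columns-label f [] = refl
columns-label f (c ∷ L) = cong (c ∷_) (columns-label f L)

bit-split : ∀ x b a y → ⟦ x ∧ (is b a ∧ y) ⟧ + ⟦ x ∧ (is (not b) a ∧ y) ⟧ ≡ ⟦ x ∧ y ⟧
bit-split false _ _ _ = refl
bit-split true true true y = +-identityʳ ⟦ y ⟧
bit-split true true false y = refl
bit-split true false true y = refl
bit-split true false false y = +-identityʳ ⟦ y ⟧

assignments : ∀ {n} → List (Fin n) → List (Pattern n)
assignments [] = [] ∷ []
assignments (c ∷ L) = map ((c , true) ∷_) (assignments L) ++ map ((c , false) ∷_) (assignments L)

∑-assignments : ∀ {n} c (L : List (Fin n)) (f : Pattern n → ℕ) →
  ∑ (assignments (c ∷ L)) f ≡ (∑[ p ∈ assignments L ] f ((c , true) ∷ p)) + (∑[ p ∈ assignments L ] f ((c , false) ∷ p))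
∑-assignments c L f =
  trans (∑-++ (map ((c , true) ∷_) (assignments L)) _ f) (cong₂ _+_ (∑-map _ (assignments L) f) (∑-map _ (assignments L) f))

columns-assignments : ∀ {n} (L : List (Fin n)) {p} → p ∈ assignments L → columns p ≡ L
columns-assignments [] (here refl) = refl
columns-assignments (c ∷ L) {p} p∈ with ∈-++⁻ (map ((c , true) ∷_) (assignments L)) p∈
... | inj₁ p∈ᵗ with ∈-map⁻ ((c , true) ∷_) p∈ᵗ
...   | q , q∈ , refl = cong (c ∷_) (columns-assignments L q∈)
columns-assignments (c ∷ L) {p} p∈ | inj₂ p∈ᶠ with ∈-map⁻ ((c , false) ∷_) p∈ᶠ
...   | q , q∈ , refl = cong (c ∷_) (columns-assignments L q∈)

length-assignments : ∀ {n} (L : List (Fin n)) → length (assignments L) ≡ 2 ^ length L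
length-assignments [] = refl
length-assignments (c ∷ L) = begin
  length (map ((c , true) ∷_) (assignments L) ++ map ((c , false) ∷_) (assignments L))
    ≡⟨ length-++ (map ((c , true) ∷_) (assignments L)) ⟩
  length (map ((c , true) ∷_) (assignments L)) + length (map ((c , false) ∷_) (assignments L))
    ≡⟨ cong₂ _+_ (length-map _ (assignments L)) (trans (length-map _ (assignments L)) (sym (+-identityʳ _))) ⟩
  length (assignments L) + (length (assignments L) + 0)
    ≡⟨ cong (λ k → k + (k + 0)) (length-assignments L) ⟩
  2 ^ suc (length L) ∎
  where open ≡-Reasoning

-- All lists of t columns, a list of length t + 1 being a column followed by a list of length t.
-- (Opaque, so that sums over its 13^t elements are never unfolded by accident.)
opaque
  tuples : ∀ {n} → ℕ → List (List (Fin n))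
  tuples zero = [] ∷ []
  tuples (suc t) = cartesianProductWith (λ L c → c ∷ L) (tuples t) (allFin _)

opaque
  unfolding tuples

  ∑-tuples-zero : ∀ {n} (f : List (Fin n) → ℕ) → ∑ (tuples 0) f ≡ f [] + 0
  ∑-tuples-zero f = refl

  ∑-tuples-suc : ∀ {n} t (f : List (Fin n) → ℕ) → ∑ (tuples (suc t)) f ≡ ∑[ L ∈ tuples t ] ∑[ c ∈ allFin n ] f (c ∷ L)
  ∑-tuples-suc t f = ∑-cartesianProductWith (λ L c → c ∷ L) (tuples t) (allFin _) f

  length-tuples : ∀ {n} t {L : List (Fin n)} → L ∈ tuples t → length L ≡ t
  length-tuples zero (here refl) = refl
  length-tuples (suc t) L∈ with ∈-cartesianProductWith⁻ (λ L c → c ∷ L) (tuples t) (allFin _) L∈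
  ... | K , c , K∈ , _ , refl = cong suc (length-tuples t K∈)

module Counting {m n : ℕ} (A : Matrix m n) where

  rows : List (Fin m)
  rows = allFin m

  matches : Fin m → Pattern n → Bool
  matches r [] = true
  matches r ((c , b) ∷ p) = is b (A r c) ∧ matches r p

  count : Pattern n → ℕ
  count p = ∑[ r ∈ rows ] ⟦ matches r p ⟧

  matches-++ : ∀ r xs ys → matches r (xs ++ ys) ≡ matches r xs ∧ matches r ys
  matches-++ r [] ys = refl
  matches-++ r ((c , b) ∷ xs) ys = trans (cong (is b (A r c) ∧_) (matches-++ r xs ys)) (sym (∧-assoc (is b (A r c)) _ _))

  count-split : ∀ xs c b ys → count (xs ++ (c , b) ∷ ys) + count (xs ++ (c , not b) ∷ ys) ≡ count (xs ++ ys)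
  count-split xs c b ys = trans (sym (∑-+ rows _ _)) (∑-cong rows (λ {r} _ → rowSplit r))
    where
    rowSplit : ∀ r → ⟦ matches r (xs ++ (c , b) ∷ ys) ⟧ + ⟦ matches r (xs ++ (c , not b) ∷ ys) ⟧ ≡ ⟦ matches r (xs ++ ys) ⟧
    rowSplit r rewrite matches-++ r xs ((c , b) ∷ ys) | matches-++ r xs ((c , not b) ∷ ys) | matches-++ r xs ys =
      bit-split (matches r xs) b (A r c) (matches r ys)

  count-[] : count [] ≡ m
  count-[] = ∑-allFin m

  matched⇒count≥1 : ∀ {p r} → T (matches r p) → 1 ≤ count p
  matched⇒count≥1 {p} {r} t = ≤-trans (≤-reflexive (sym (⟦T⟧ t))) (term≤∑ (λ r → ⟦ matches r p ⟧) (∈-allFin r))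

  lookup-columns-injective : ∀ {p : Pattern n} → Distinct p → Injective _≡_ _≡_ (proj₁ ∘ lookup p)
  lookup-columns-injective {_ ∷ p} _ {zero} {zero} _ = refl
  lookup-columns-injective {_ ∷ p} (c∉ ∷ _) {zero} {suc j} eq = ⊥-elim (All.lookup c∉ (∈-map⁺ proj₁ (∈-lookup j)) eq)
  lookup-columns-injective {_ ∷ p} (c∉ ∷ _) {suc i} {zero} eq = ⊥-elim (All.lookup c∉ (∈-map⁺ proj₁ (∈-lookup i)) (sym eq))
  lookup-columns-injective {_ ∷ p} (_ ∷ d) {suc i} {suc j} eq = cong suc (lookup-columns-injective d eq)

  matches-lookup : ∀ {r} (p : Pattern n) → (∀ i → A r (proj₁ (lookup p i)) ≡ proj₂ (lookup p i)) → T (matches r p)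
  matches-lookup [] _ = tt
  matches-lookup {r} ((c , b) ∷ p) row =
    Equivalence.from T-∧ (subst (T ∘ is b) (sym (row zero)) (is-refl b) , matches-lookup p (row ∘ suc))

  covering⇒matched : ∀ {t} → IsCoveringArray t m n A → ∀ p → Distinct p → length p ≡ t → ∃ λ r → T (matches r p)
  covering⇒matched cov p d refl with cov (proj₁ ∘ lookup p) (lookup-columns-injective d) (proj₂ ∘ lookup p)
  ... | r , row = r , matches-lookup p row

  AtLeast AtMost : ℕ → ℕ → Set
  AtLeast k t = ∀ p → Distinct p → length p ≡ t → k ≤ count p
  AtMost k t = ∀ p → Distinct p → length p ≡ t → count p ≤ k

  -- Strength reduction: a fresh column splits a t-pattern into two (t+1)-patterns.
  double : ∀ {k t} → AtLeast k (suc t) → t < n → AtLeast (k + k) t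
  double {k} atLeast t<n p d refl with fresh (columns p) (subst (_< n) (sym (length-map proj₁ p)) t<n)
  ... | c , c∉ = subst (k + k ≤_) (count-split [] c true p)
                   (+-mono-≤ (atLeast ((c , true) ∷ p) d' refl) (atLeast ((c , false) ∷ p) d' refl))
    where
    d' : Unique (c ∷ columns p)
    d' = ¬Any⇒All¬ _ c∉ ∷ d

  halve : ∀ {k t} → AtLeast k (suc t) → AtMost (k + k) t → AtMost k (suc t)
  halve {k} atLeast atMost ((c , b) ∷ p) d@(_ ∷ dp) refl =
    +-cancelʳ-≤ k _ k (≤-trans (+-monoʳ-≤ (count ((c , b) ∷ p)) (atLeast ((c , not b) ∷ p) d refl))
                               (≤-trans (≤-reflexive (count-split [] c b p)) (atMost p dp refl)))

  matchingRows : Pattern n → List (Fin m)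
  matchingRows p = filterᵇ (λ r → matches r p) rows

  length-matchingRows : ∀ p → length (matchingRows p) ≡ count p
  length-matchingRows p = go rows
    where
    go : ∀ rs → length (filterᵇ (λ r → matches r p) rs) ≡ ∑[ r ∈ rs ] ⟦ matches r p ⟧
    go [] = refl
    go (r ∷ rs) with matches r p
    ... | true = cong suc (go rs)
    ... | false = go rs

  -- If five columns e avoid
  -- the columns of p, the rows matching p, read on e, form a binary 2-covering array; as no such
  -- array has only five rows, at least six rows match p.
  sixMatches : ∀ p → Distinct p → (∀ q → Distinct q → length q ≡ suc (suc (length p)) → ∃ λ r → T (matches r q)) →
               (e : Fin 5 → Fin n) → Injective _≡_ _≡_ e → (∀ a → e a ∉ columns p) → 6 ≤ count p
  sixMatches p d matched e e-inj e∉ = ≮⇒≥ λ count<6 → noSmallTwoCovering readings (few count<6) twoCovering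
    where
    readings : List (Fin 5 → Bool)
    readings = map (λ r a → A r (e a)) (matchingRows p)

    few : count p < 6 → length readings ≤ 5
    few (s≤s count≤5) = subst (_≤ 5) (sym (trans (length-map _ (matchingRows p)) (length-matchingRows p))) count≤5

    twoCovering : TwoCovering readings
    twoCovering {a} {b} a≢b u v with matched ((e a , u) ∷ (e b , v) ∷ p) distinct refl
      where
      distinct : Distinct ((e a , u) ∷ (e b , v) ∷ p)
      distinct = ((a≢b ∘ e-inj) ∷ ¬Any⇒All¬ _ (e∉ a)) ∷ ¬Any⇒All¬ _ (e∉ b) ∷ d
    ... | r , r-matches with split₃ {is u (A r (e a))} r-matches
    ... | ra , rb , rp = AnyP.map⁺ (lose (∈-filter⁺ (T? ∘ λ r → matches r p) (∈-allFin r) rp) (is-sound ra , is-sound rb))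

  atLeastSix : ∀ {t} → (∀ q → Distinct q → length q ≡ suc (suc t) → ∃ λ r → T (matches r q)) →
               t + 5 ≤ n → AtLeast 6 t
  atLeastSix matched room p d refl = sixMatches p d matched (proj₁ fresh5) (proj₁ (proj₂ fresh5)) (proj₂ (proj₂ fresh5))
    where
    fresh5 = freshColumns 5 (columns p) (subst (λ ℓ → ℓ + 5 ≤ n) (sym (length-map proj₁ p)) room)

  restrict : Fin m → List (Fin n) → Pattern n
  restrict r L = map (λ c → c , A r c) L

  -- The number of ordered pairs of rows agreeing on all columns of L.
  coincidences : List (Fin n) → ℕ
  coincidences L = ∑[ r ∈ rows ] count (restrict r L)

  -- A row matches exactly one pattern on L, namely its own restriction to L.
  restrict-unique : ∀ r L (h : Pattern n → ℕ) → h (restrict r L) ≡ ∑[ p ∈ assignments L ] ⟦ matches r p ⟧ * h p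
  restrict-unique r [] h = sym (trans (+-identityʳ _) (+-identityʳ (h [])))
  restrict-unique r (c ∷ L) h = sym (begin
    ∑[ p ∈ assignments (c ∷ L) ] ⟦ matches r p ⟧ * h p
      ≡⟨ ∑-assignments c L _ ⟩
    (∑[ p ∈ assignments L ] ⟦ is true (A r c) ∧ matches r p ⟧ * h ((c , true) ∷ p))
      + (∑[ p ∈ assignments L ] ⟦ is false (A r c) ∧ matches r p ⟧ * h ((c , false) ∷ p))
      ≡⟨ select (A r c) ⟩
    ∑[ p ∈ assignments L ] ⟦ matches r p ⟧ * h ((c , A r c) ∷ p)
      ≡⟨ sym (restrict-unique r L (h ∘ ((c , A r c) ∷_))) ⟩
    h ((c , A r c) ∷ restrict r L) ∎)
    where
    open ≡-Reasoning
    -- Only the half of the patterns agreeing with the row on c contributes.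
    select : ∀ x → (∑[ p ∈ assignments L ] ⟦ is true x ∧ matches r p ⟧ * h ((c , true) ∷ p))
                   + (∑[ p ∈ assignments L ] ⟦ is false x ∧ matches r p ⟧ * h ((c , false) ∷ p))
                   ≡ ∑[ p ∈ assignments L ] ⟦ matches r p ⟧ * h ((c , x) ∷ p)
    select true = trans (cong ((∑[ p ∈ assignments L ] ⟦ matches r p ⟧ * h ((c , true) ∷ p)) +_) (∑-0 (assignments L))) (+-identityʳ _)
    select false = cong (_+ (∑[ p ∈ assignments L ] ⟦ matches r p ⟧ * h ((c , false) ∷ p))) (∑-0 (assignments L))

  ∑-restrict : ∀ L (h : Pattern n → ℕ) → ∑[ r ∈ rows ] h (restrict r L) ≡ ∑[ p ∈ assignments L ] count p * h p
  ∑-restrict L h = begin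
    ∑[ r ∈ rows ] h (restrict r L)                                 ≡⟨ ∑-cong rows (λ {r} _ → restrict-unique r L h) ⟩
    ∑[ r ∈ rows ] ∑[ p ∈ assignments L ] ⟦ matches r p ⟧ * h p      ≡⟨ ∑-swap rows (assignments L) _ ⟩
    ∑[ p ∈ assignments L ] ∑[ r ∈ rows ] ⟦ matches r p ⟧ * h p      ≡⟨ ∑-cong (assignments L) (λ {p} _ → ∑-*ʳ rows (h p) _) ⟩
    ∑[ p ∈ assignments L ] count p * h p                           ∎
    where open ≡-Reasoning

  ∑-count : ∀ L → ∑[ p ∈ assignments L ] count p ≡ m
  ∑-count L = trans (∑-cong (assignments L) (λ {p} _ → sym (*-identityʳ (count p))))
                    (trans (sym (∑-restrict L (λ _ → 1))) count-[])

  coincidences-squares : ∀ L → coincidences L ≡ ∑[ p ∈ assignments L ] count p * count p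
  coincidences-squares L = ∑-restrict L count

  matches-restrict : ∀ r r' L → T (matches r' (restrict r L)) ⇔ All (λ c → A r' c ≡ A r c) L
  matches-restrict r r' [] = mk⇔ (λ _ → []) (λ _ → tt)
  matches-restrict r r' (c ∷ L) = mk⇔
    (λ t → let (t₁ , t₂) = Equivalence.to T-∧ t in is-sound t₁ ∷ Equivalence.to (matches-restrict r r' L) t₂)
    (λ { (eq ∷ eqs) → Equivalence.from T-∧ (subst (T ∘ is (A r c)) (sym eq) (is-refl (A r c)) , Equivalence.from (matches-restrict r r' L) eqs) })

  coincidences-deduplicate : ∀ L → coincidences L ≡ coincidences (deduplicate Fin._≟_ L)
  coincidences-deduplicate L = ∑-cong rows λ {r} _ → ∑-cong rows λ {r'} _ → cong ⟦_⟧ (T-ext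
    (Equivalence.from (matches-restrict r r' D) ∘ AllP.deduplicate⁺ Fin._≟_ ∘ Equivalence.to (matches-restrict r r' L))
    (Equivalence.from (matches-restrict r r' L) ∘ AllP.deduplicate⁻ Fin._≟_ (λ { refl eq → eq }) L ∘ Equivalence.to (matches-restrict r r' D)))
    where D = deduplicate Fin._≟_ L

  agreement : Fin m × Fin m → ℕ
  agreement (r , r') = ∑[ c ∈ allFin n ] ⟦ is (A r c) (A r' c) ⟧

  agreement-diag : ∀ r → agreement (r , r) ≡ n
  agreement-diag r = trans (∑-cong (allFin n) (λ {c} _ → ⟦T⟧ (is-refl (A r c)))) (∑-allFin n)

  rowPairs : List (Fin m × Fin m)
  rowPairs = cartesianProduct rows rows

  -- Expanding the t-th power of a sum of indicators into a sum over t-tuples of columns.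
  agreement-power : ∀ r r' t → agreement (r , r') ^ t ≡ ∑[ L ∈ tuples t ] ⟦ matches r' (restrict r L) ⟧
  agreement-power r r' zero = sym (∑-tuples-zero _)
  agreement-power r r' (suc t) = sym (begin
    ∑[ L ∈ tuples (suc t) ] ⟦ matches r' (restrict r L) ⟧
      ≡⟨ ∑-tuples-suc t _ ⟩
    ∑[ L ∈ tuples t ] ∑[ c ∈ allFin n ] ⟦ agree c ∧ matches r' (restrict r L) ⟧
      ≡⟨ ∑-cong (tuples t) (λ {L} _ → trans (∑-cong (allFin n) (λ {c} _ → ⟦∧⟧ (agree c) _)) (∑-*ʳ (allFin n) _ (⟦_⟧ ∘ agree))) ⟩
    ∑[ L ∈ tuples t ] agreement (r , r') * ⟦ matches r' (restrict r L) ⟧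
      ≡⟨ ∑-*ˡ (tuples t) (agreement (r , r')) _ ⟩
    agreement (r , r') * (∑[ L ∈ tuples t ] ⟦ matches r' (restrict r L) ⟧)
      ≡⟨ cong (agreement (r , r') *_) (sym (agreement-power r r' t)) ⟩
    agreement (r , r') ^ suc t ∎)
    where
    open ≡-Reasoning
    agree : Fin n → Bool
    agree c = is (A r c) (A r' c)

  power-moment : ∀ t → ∑[ rr ∈ rowPairs ] agreement rr ^ t ≡ ∑[ L ∈ tuples t ] coincidences L
  power-moment t = begin
    ∑[ rr ∈ rowPairs ] agreement rr ^ t
      ≡⟨ ∑-cartesianProductWith _,_ rows rows (λ rr → agreement rr ^ t) ⟩
    ∑[ r ∈ rows ] ∑[ r' ∈ rows ] agreement (r , r') ^ t
      ≡⟨ ∑-cong rows (λ {r} _ → ∑-cong rows (λ {r'} _ → agreement-power r r' t)) ⟩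
    ∑[ r ∈ rows ] ∑[ r' ∈ rows ] ∑[ L ∈ tuples t ] ⟦ matches r' (restrict r L) ⟧
      ≡⟨ ∑-cong rows (λ {r} _ → ∑-swap rows (tuples t) _) ⟩
    ∑[ r ∈ rows ] ∑[ L ∈ tuples t ] count (restrict r L)
      ≡⟨ ∑-swap rows (tuples t) _ ⟩
    ∑[ L ∈ tuples t ] coincidences L ∎
    where open ≡-Reasoning

module FortyEightRows {n} (A : Matrix 48 n) (covering : IsCoveringArray 5 48 n A) (8≤n : 8 ≤ n) where

  open Counting A

  -- Lower bounds: every distinct 5-pattern is matched; splitting on fresh columns doubles a
  -- bound when passing to one column fewer, and the 2-covering argument gives 6 for 3 columns.
  fits : ∀ {k} → k ≤ 8 → k ≤ n
  fits k≤8 = ≤-trans k≤8 8≤n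

  matched : ∀ p → Distinct p → length p ≡ 5 → ∃ λ r → T (matches r p)
  matched = covering⇒matched covering

  atLeast1-5 : AtLeast 1 5
  atLeast1-5 p d len = matched⇒count≥1 {p} (proj₂ (matched p d len))

  atLeast2-4 : AtLeast 2 4
  atLeast2-4 = double atLeast1-5 (fits (s≤s (s≤s (s≤s (s≤s (s≤s z≤n))))))

  atLeast6-3 : AtLeast 6 3
  atLeast6-3 = atLeastSix matched 8≤n

  atLeast12-2 : AtLeast 12 2
  atLeast12-2 = double atLeast6-3 (fits (s≤s (s≤s (s≤s z≤n))))

  atLeast24-1 : AtLeast 24 1
  atLeast24-1 = double atLeast12-2 (fits (s≤s (s≤s z≤n)))

  -- Since 48 = 8 · 6, these lower bounds are attained exactly.
  atMost48-0 : AtMost 48 0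
  atMost48-0 [] _ _ = ≤-reflexive count-[]

  atMost24-1 : AtMost 24 1
  atMost24-1 = halve atLeast24-1 atMost48-0

  atMost12-2 : AtMost 12 2
  atMost12-2 = halve atLeast12-2 atMost24-1

  atMost6-3 : AtMost 6 3
  atMost6-3 = halve atLeast6-3 atMost12-2

  share : ℕ → ℕ
  share 0 = 48
  share 1 = 24
  share 2 = 12
  share _ = 6

  exact : ∀ p → Distinct p → length p ≤ 3 → count p ≡ share (length p)
  exact [] _ _ = count-[]
  exact p@(_ ∷ []) d _ = ≤-antisym (atMost24-1 p d refl) (atLeast24-1 p d refl)
  exact p@(_ ∷ _ ∷ []) d _ = ≤-antisym (atMost12-2 p d refl) (atLeast12-2 p d refl)
  exact p@(_ ∷ _ ∷ _ ∷ []) d _ = ≤-antisym (atMost6-3 p d refl) (atLeast6-3 p d refl)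
  exact (_ ∷ _ ∷ _ ∷ _ ∷ _) _ (s≤s (s≤s (s≤s ())))

  flip : ∀ xs c b ys → Distinct (xs ++ (c , b) ∷ ys) → length (xs ++ (c , b) ∷ ys) ≡ 4 →
         count (xs ++ (c , b) ∷ ys) + count (xs ++ (c , not b) ∷ ys) ≡ 6
  flip xs c b ys d len = trans (count-split xs c b ys) (trans (exact (xs ++ ys) d' (≤-reflexive len')) (cong share len'))
    where
    d' : Distinct (xs ++ ys)
    d' = subst Unique (sym (map-++ proj₁ xs ys)) (Unique-remove (columns xs) (columns ys) (subst Unique (map-++ proj₁ xs _) d))
    len' : length (xs ++ ys) ≡ 3
    len' = suc-injective (trans (sym (length-++-sucʳ xs (c , b) ys)) len)

  flip-3 : ∀ xs c b b' ys → Distinct (xs ++ (c , b) ∷ ys) → length (xs ++ (c , b) ∷ ys) ≡ 4 →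
           count (xs ++ (c , b) ∷ ys) ≡ 3 → count (xs ++ (c , b') ∷ ys) ≡ 3
  flip-3 xs c true true ys d len three = three
  flip-3 xs c false false ys d len three = three
  flip-3 xs c true false ys d len three = complement-3 (flip xs c true ys d len) three
  flip-3 xs c false true ys d len three = complement-3 (flip xs c false ys d len) three

  spread : ∀ xs ys zs → columns ys ≡ columns zs → Distinct (xs ++ ys) → length (xs ++ ys) ≡ 4 →
           count (xs ++ ys) ≡ 3 → count (xs ++ zs) ≡ 3
  spread xs [] [] _ _ _ three = three
  spread xs ((c , b) ∷ ys) ((_ , b') ∷ zs) same d len three with ∷-injective same
  ... | refl , same' = subst (λ p → count p ≡ 3) (++-assoc xs _ zs)
    (spread (xs ++ (c , b') ∷ []) ys zs same' (subst Distinct (sym (++-assoc xs _ ys)) d')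
      (trans (cong length (++-assoc xs _ ys)) len') (trans (cong count (++-assoc xs _ ys)) (flip-3 xs c b b' ys d len three)))
    where
    d' : Distinct (xs ++ (c , b') ∷ ys)
    d' = subst Unique (columns-++ xs c b b' ys) d
    len' : length (xs ++ (c , b') ∷ ys) ≡ 4
    len' = trans (length-++-sucʳ xs _ ys) (trans (sym (length-++-sucʳ xs _ ys)) len)

  -- Four distinct columns are balanced when the all-false pattern on them has count 3
  -- (and then, by spread, every pattern on them has).
  balanced : List (Fin n) → Bool
  balanced L = count (map (λ c → c , false) L) ≡ᵇ 3

  count-on-block : ∀ L → Unique L → length L ≡ 4 → ∀ {p} → p ∈ assignments L →
                   2 ≤ count p × count p ≤ 4 × (T (balanced L) → count p ≡ 3)
  count-on-block L u len {p} p∈ = atLeast2-4 p d lenp , atMost4 p d lenp , balanced⇒3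
    where
    cols : columns p ≡ L
    cols = columns-assignments L p∈
    d : Distinct p
    d = subst Unique (sym cols) u
    lenp : length p ≡ 4
    lenp = trans (sym (length-map proj₁ p)) (trans (cong length cols) len)
    atMost4 : ∀ p → Distinct p → length p ≡ 4 → count p ≤ 4
    atMost4 ((c , b) ∷ q) d lenp = +-cancelʳ-≤ 2 _ 4
      (≤-trans (+-monoʳ-≤ (count ((c , b) ∷ q)) (atLeast2-4 ((c , not b) ∷ q) d lenp)) (≤-reflexive (flip [] c b q d lenp)))
    balanced⇒3 : T (balanced L) → count p ≡ 3
    balanced⇒3 bal = spread [] (map (λ c → c , false) L) p (trans (columns-label (λ _ → false) L) (sym cols))
      (subst Unique (sym (columns-label (λ _ → false) L)) u) (trans (length-map _ L) len) (≡ᵇ⇒≡ _ 3 bal)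

  -- Hence the coincidences on four distinct columns: the sum of the 16 squared counts, which sum to 48,
  -- is 144 when they are balanced and at most 160 otherwise.
  block-bound : ∀ L → Unique L → length L ≡ 4 → coincidences L ≤ 16 * ⟦ not (balanced L) ⟧ + 144
  block-bound L u len = +-cancelʳ-≤ 144 _ _ (begin
    coincidences L + 144                              ≡⟨ cong₂ _+_ (coincidences-squares L) (sym sixteen-9) ⟩
    (∑[ p ∈ ps ] count p * count p) + (∑[ p ∈ ps ] 9)  ≡⟨ sym (∑-+ ps _ _) ⟩
    ∑[ p ∈ ps ] (count p * count p + 9)                ≤⟨ ∑-mono ps pointwise ⟩
    ∑[ p ∈ ps ] (6 * count p + f)                      ≡⟨ ∑-+ ps _ _ ⟩
    (∑[ p ∈ ps ] 6 * count p) + (∑[ p ∈ ps ] f)        ≡⟨ cong₂ _+_ (trans (∑-*ˡ ps 6 count) (cong (6 *_) (∑-count L))) sixteen-f ⟩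
    6 * 48 + 16 * f                                   ≡⟨ rearrange f ⟩
    16 * f + 144 + 144                                ∎)
    where
    open ≤-Reasoning
    ps = assignments L
    f = ⟦ not (balanced L) ⟧
    #ps : length ps ≡ 16
    #ps = trans (length-assignments L) (cong (2 ^_) len)
    sixteen-9 : ∑[ p ∈ ps ] 9 ≡ 16 * 9
    sixteen-9 = trans (∑-const ps 9) (cong (_* 9) {x = length ps} #ps)
    sixteen-f : ∑[ p ∈ ps ] f ≡ 16 * f
    sixteen-f = trans (∑-const ps f) (cong (_* f) {x = length ps} #ps)
    pointwise : ∀ {p} → p ∈ ps → count p * count p + 9 ≤ 6 * count p + f
    pointwise p∈ with count-on-block L u len p∈
    ... | 2≤ , ≤4 , bal⇒3 = square-bound _ f 2≤ ≤4 (λ f≡0 → bal⇒3 (balanced-if f≡0))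
      where
      balanced-if : f ≡ 0 → T (balanced L)
      balanced-if with balanced L
      ... | true = λ _ → tt
      ... | false = λ ()
    rearrange : ∀ f → 6 * 48 + 16 * f ≡ 16 * f + 144 + 144
    rearrange = solve-∀

  unbalanced-split : ∀ l K → Unique (l ∷ K) → length K ≡ 3 → ¬ T (balanced (l ∷ K)) →
    ∃ λ u → count ((l , u) ∷ map (λ c → c , false) K) ≡ 4 × count ((l , not u) ∷ map (λ c → c , false) K) ≡ 2
  unbalanced-split l K u len unbal = choose (λ b → count ((l , b) ∷ F))
    (four-and-two _ _ (flip [] l true F d lenF) (atLeast2-4 ((l , true) ∷ F) d lenF) (atLeast2-4 ((l , false) ∷ F) d lenF) (unbal ∘ ≡⇒≡ᵇ _ 3))
    where
    F = map (λ c → c , false) K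
    d : Distinct ((l , true) ∷ F)
    d = subst Unique (sym (cong (l ∷_) (columns-label (λ _ → false) K))) u
    lenF : length ((l , true) ∷ F) ≡ 4
    lenF = cong suc (trans (length-map _ K) len)

  -- The core of the packing argument: for distinct columns l, l', i, j, k, if the pattern
  -- (not u, false, false, false) on (l, i, j, k) has count 2 and (v, false, false, false) on
  -- (l', i, j, k) has count 4, then too many rows would show (u, v, false) on (l, l', i).
  -- A parity argument transfers both counts to the values (false, true, true) on (i, j, k); in both
  -- cases at least 3 rows show (u, v) on (l, l'), and with the two remaining value pairs on (j, k)
  -- this gives 3 + 1 + 1 + 3 > 6 rows.
  overfull : ∀ {l l' i j k} → ¬ l ≡ l' → Unique (l ∷ i ∷ j ∷ k ∷ []) → Unique (l' ∷ i ∷ j ∷ k ∷ []) → ∀ u v →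
             count ((l , not u) ∷ (i , false) ∷ (j , false) ∷ (k , false) ∷ []) ≡ 2 →
             count ((l' , v) ∷ (i , false) ∷ (j , false) ∷ (k , false) ∷ []) ≡ 4 → 8 ≤ 6
  overfull {l} {l'} {i} {j} {k} l≢l' d@(l∉ ∷ dK) d'@(l'∉ ∷ _) u v b≡2 a≡4 = begin
    3 + 1 + (1 + 3)
      ≤⟨ +-mono-≤ (+-mono-≤ (slice true true (trans (parity l d (not u)) b≡2) (trans (parity l' d' v) a≡4))
                            (atLeast1-5 ((l , u) ∷ (l' , v) ∷ (i , false) ∷ (j , true) ∷ (k , false) ∷ []) d₅ refl))
                  (+-mono-≤ (atLeast1-5 ((l , u) ∷ (l' , v) ∷ (i , false) ∷ (j , false) ∷ (k , true) ∷ []) d₅ refl)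
                            (slice false false b≡2 a≡4)) ⟩
    (N u v true true + N u v true false) + (N u v false true + N u v false false)
      ≡⟨ total ⟩
    6 ∎
    where
    open ≤-Reasoning

    N : Bool → Bool → Bool → Bool → ℕ
    N x y t₂ t₃ = count ((l , x) ∷ (l' , y) ∷ (i , false) ∷ (j , t₂) ∷ (k , t₃) ∷ [])

    d₅ : Unique (l ∷ l' ∷ i ∷ j ∷ k ∷ [])
    d₅ = (l≢l' ∷ l∉) ∷ l'∉ ∷ dK

    parity : ∀ c → Unique (c ∷ i ∷ j ∷ k ∷ []) → ∀ x →
      count ((c , x) ∷ (i , false) ∷ (j , true) ∷ (k , true) ∷ []) ≡ count ((c , x) ∷ (i , false) ∷ (j , false) ∷ (k , false) ∷ [])
    parity c dc x = same-complement (flip ((c , x) ∷ (i , false) ∷ (j , true) ∷ []) k true [] dc refl)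
                                    (flip ((c , x) ∷ (i , false) ∷ []) j true ((k , false) ∷ []) dc refl)

    slice : ∀ t₂ t₃ → count ((l , not u) ∷ (i , false) ∷ (j , t₂) ∷ (k , t₃) ∷ []) ≡ 2 →
            count ((l' , v) ∷ (i , false) ∷ (j , t₂) ∷ (k , t₃) ∷ []) ≡ 4 → 3 ≤ N u v t₂ t₃
    slice t₂ t₃ b≡2 a≡4 = slice-bound (N u v t₂ t₃) (N (not u) v t₂ t₃) (N (not u) (not v) t₂ t₃)
      (trans (count-split [] l u ((l' , v) ∷ K)) a≡4)
      (trans (count-split ((l , not u) ∷ []) l' v K) b≡2)
      (atLeast1-5 ((l , not u) ∷ (l' , not v) ∷ K) d₅ refl)
      where K = (i , false) ∷ (j , t₂) ∷ (k , t₃) ∷ []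

    total : (N u v true true + N u v true false) + (N u v false true + N u v false false) ≡ 6
    total = trans (cong₂ _+_ (count-split ((l , u) ∷ (l' , v) ∷ (i , false) ∷ (j , true) ∷ []) k true [])
                             (count-split ((l , u) ∷ (l' , v) ∷ (i , false) ∷ (j , false) ∷ []) k true []))
            (trans (count-split ((l , u) ∷ (l' , v) ∷ (i , false) ∷ []) j true [])
                   (exact ((l , u) ∷ (l' , v) ∷ (i , false) ∷ []) (Unique-remove (l ∷ l' ∷ i ∷ []) []
                     (Unique-remove (l ∷ l' ∷ i ∷ []) (k ∷ []) d₅)) (s≤s (s≤s (s≤s z≤n)))))

  packing : ∀ {l l' i j k} → ¬ l ≡ l' → Unique (l ∷ i ∷ j ∷ k ∷ []) → Unique (l' ∷ i ∷ j ∷ k ∷ []) →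
            ¬ T (balanced (l ∷ i ∷ j ∷ k ∷ [])) → ¬ T (balanced (l' ∷ i ∷ j ∷ k ∷ [])) → ⊥
  packing {l} {l'} {i} {j} {k} l≢l' d d' unbal unbal' =
    let (u , _ , b≡2) = unbalanced-split l (i ∷ j ∷ k ∷ []) d refl unbal
        (v , a≡4 , _) = unbalanced-split l' (i ∷ j ∷ k ∷ []) d' refl unbal'
    in <⇒≱ (s≤s (s≤s (s≤s (s≤s (s≤s (s≤s (s≤s z≤n))))))) (overfull l≢l' d d' u v b≡2 a≡4)

-- The final arithmetic: with the moments s₀, …, s₃ known exactly and s₄ bounded in terms of the
-- number f of flagged 4-tuples, the summed quartic bound would read 30652608 ≤ 30639184.
incompatible-moments : ∀ {s₀ s₁ s₂ s₃ s₄ b₄ f d} → s₀ ≡ 2304 → s₁ ≡ 14976 → s₂ ≡ 104832 → s₃ ≡ 778752 → b₄ ≡ 6080256 → d ≡ 48 →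
  f ≤ 2197 → s₄ ≤ 16 * f + b₄ → 24 * s₃ + 792 * s₁ + 2116 * d ≤ 1 * s₄ + 210 * s₂ + 1089 * s₀ → ⊥
incompatible-moments {s₄ = s₄} refl refl refl refl refl refl f≤2197 s₄≤ summed = ≤⇒≤ᵇ (≤-trans summed fourth)
  where
  s₄≤6115408 : s₄ ≤ 6115408
  s₄≤6115408 = ≤-trans s₄≤ (+-monoˡ-≤ 6080256 (*-monoʳ-≤ 16 f≤2197))
  fourth : 1 * s₄ + 210 * 104832 + 1089 * 2304 ≤ 1 * 6115408 + 210 * 104832 + 1089 * 2304
  fourth = +-monoˡ-≤ (1089 * 2304) (+-monoˡ-≤ (210 * 104832) (*-monoʳ-≤ 1 s₄≤6115408))

module Thirteen (A : Matrix 48 13) (covering : IsCoveringArray 5 48 13 A) where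

  open Counting A
  open FortyEightRows A covering (s≤s (s≤s (s≤s (s≤s (s≤s (s≤s (s≤s (s≤s z≤n))))))))
  open import Data.List.Relation.Unary.Unique.DecPropositional (Fin._≟_ {13}) using (unique?)
  open import Data.List.Relation.Unary.Unique.DecPropositional.Properties (Fin._≟_ {13}) using (deduplicate-!)

  distinctCount : List (Fin 13) → ℕ
  distinctCount L = length (deduplicate Fin._≟_ L)

  -- The coincidences on d ≤ 3 distinct columns, 48 · 48 / 2^d; for d = 4 the value 144 of a balanced block.
  baseline : ℕ → ℕ
  baseline 0 = 2304
  baseline 1 = 1152
  baseline 2 = 576
  baseline 3 = 288
  baseline _ = 144

  coincidences-distinct : ∀ D → Unique D → length D ≤ 3 → coincidences D ≡ baseline (length D)
  coincidences-distinct D u len = trans (∑-cong rows (λ {r} _ → exact-restrict r)) (table (length D) len)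
    where
    exact-restrict : ∀ r → count (restrict r D) ≡ share (length D)
    exact-restrict r = trans (exact (restrict r D) (subst Unique (sym (columns-label (A r) D)) u)
                                    (≤-trans (≤-reflexive (length-map _ D)) len))
                             (cong share (length-map _ D))
    table : ∀ d → d ≤ 3 → ∑[ r ∈ rows ] share d ≡ baseline d
    table 0 _ = refl
    table 1 _ = refl
    table 2 _ = refl
    table 3 _ = refl
    table (suc (suc (suc (suc _)))) (s≤s (s≤s (s≤s ())))

  flag : List (Fin 13) → ℕ
  flag L = ⟦ isYes (unique? L) ∧ not (balanced L) ⟧

  tuple-exact : ∀ L → length L ≤ 3 → coincidences L ≡ baseline (distinctCount L)
  tuple-exact L len = trans (coincidences-deduplicate L)
    (coincidences-distinct (deduplicate Fin._≟_ L) (deduplicate-! L) (≤-trans (length-deduplicate Fin._≟_ L) len))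

  tuple-bound : ∀ L → length L ≡ 4 → coincidences L ≤ 16 * flag L + baseline (distinctCount L)
  tuple-bound L len = by-distinctCount (distinctCount L ≤? 3)
    where
    by-distinctCount : Dec (distinctCount L ≤ 3) → coincidences L ≤ 16 * flag L + baseline (distinctCount L)
    by-distinctCount (yes few) = ≤-trans (≤-reflexive (trans (coincidences-deduplicate L)
      (coincidences-distinct (deduplicate Fin._≟_ L) (deduplicate-! L) few))) (m≤n+m _ _)
    by-distinctCount (no many) = subst₂ (λ D f → coincidences L ≤ 16 * f + baseline (length D)) (sym dedup≡L) (sym flag≡)
      (subst (λ d → coincidences L ≤ 16 * ⟦ not (balanced L) ⟧ + baseline d) (sym len) (block-bound L uL len))
      where
      dedup≡L : deduplicate Fin._≟_ L ≡ L
      dedup≡L = deduplicate-complete Fin._≟_ L (trans (≤-antisym (≤-trans (length-deduplicate Fin._≟_ L) (≤-reflexive len)) (≰⇒> many)) (sym len))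
      uL : Unique L
      uL = subst Unique dedup≡L (deduplicate-! L)
      flag≡ : flag L ≡ ⟦ not (balanced L) ⟧
      flag≡ = cong (λ b → ⟦ b ∧ not (balanced L) ⟧) (Equivalence.to T-≡ (fromWitness {a? = unique? L} uL))

  opaque
    unfolding tuples
    #triples : ∑[ K ∈ tuples {13} 3 ] 1 ≡ 2197
    #triples = refl

  -- By packing, a triple of columns is completed to a flagged 4-tuple by at most one column.
  flags-per-triple : ∀ K → length K ≡ 3 → ∑[ c ∈ allFin 13 ] flag (c ∷ K) ≤ 1
  flags-per-triple K@(_ ∷ _ ∷ _ ∷ []) _ = ∑-atMostOne (allFin⁺ 13) (λ c → flag (c ∷ K)) (λ c → ⟦⟧≤1 _) exclusive
    where
    flagged : ∀ {L} → 1 ≤ flag L → Unique L × ¬ T (balanced L)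
    flagged {L} f≥1 = let (unique , unbalanced) = Equivalence.to T-∧ (⟦⟧≥1 f≥1)
                      in toWitness {a? = unique? L} unique , T-not unbalanced
    exclusive : ∀ {c c'} → ¬ c ≡ c' → 1 ≤ flag (c ∷ K) → flag (c' ∷ K) ≡ 0
    exclusive {c} {c'} c≢c' f≥1 = ≤1-not-≥1 (⟦⟧≤1 _) λ f'≥1 →
      let (d , unbal) = flagged {c ∷ K} f≥1
          (d' , unbal') = flagged {c' ∷ K} f'≥1
      in packing c≢c' d d' unbal unbal'

  flags-bound : ∑[ L ∈ tuples 4 ] flag L ≤ 2197
  flags-bound = begin
    ∑[ L ∈ tuples 4 ] flag L                           ≡⟨ ∑-tuples-suc 3 flag ⟩
    ∑[ K ∈ tuples 3 ] ∑[ c ∈ allFin 13 ] flag (c ∷ K)   ≤⟨ ∑-mono (tuples 3) (λ {K} K∈ → flags-per-triple K (length-tuples 3 K∈)) ⟩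
    ∑[ K ∈ tuples 3 ] 1                                ≡⟨ #triples ⟩
    2197                                               ∎
    where open ≤-Reasoning

  moment : ℕ → ℕ
  moment t = ∑[ rr ∈ rowPairs ] agreement rr ^ t

  opaque
    unfolding tuples
    baselines-0 : ∑[ L ∈ tuples 0 ] baseline (distinctCount L) ≡ 2304
    baselines-0 = refl
    baselines-1 : ∑[ L ∈ tuples 1 ] baseline (distinctCount L) ≡ 14976
    baselines-1 = refl
    baselines-2 : ∑[ L ∈ tuples 2 ] baseline (distinctCount L) ≡ 104832
    baselines-2 = refl
    baselines-3 : ∑[ L ∈ tuples 3 ] baseline (distinctCount L) ≡ 778752
    baselines-3 = refl
    baselines-4 : ∑[ L ∈ tuples 4 ] baseline (distinctCount L) ≡ 6080256
    baselines-4 = refl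

  moment-exact : ∀ t {v} → t ≤ 3 → ∑[ L ∈ tuples t ] baseline (distinctCount L) ≡ v → moment t ≡ v
  moment-exact t t≤3 value = trans (power-moment t)
    (trans (∑-cong (tuples t) λ {L} L∈ → tuple-exact L (≤-trans (≤-reflexive (length-tuples t L∈)) t≤3)) value)

  moment-4 : moment 4 ≤ 16 * (∑[ L ∈ tuples 4 ] flag L) + (∑[ L ∈ tuples 4 ] baseline (distinctCount L))
  moment-4 = begin
    moment 4                                                      ≡⟨ power-moment 4 ⟩
    ∑[ L ∈ tuples 4 ] coincidences L                              ≤⟨ ∑-mono (tuples 4) (λ {L} L∈ → tuple-bound L (length-tuples 4 L∈)) ⟩
    ∑[ L ∈ tuples 4 ] (16 * flag L + baseline (distinctCount L))  ≡⟨ ∑-+ (tuples 4) (λ L → 16 * flag L) (λ L → baseline (distinctCount L)) ⟩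
    (∑[ L ∈ tuples 4 ] 16 * flag L) + (∑[ L ∈ tuples 4 ] baseline (distinctCount L))
                                                                  ≡⟨ cong (_+ (∑[ L ∈ tuples 4 ] baseline (distinctCount L))) (∑-*ˡ (tuples 4) 16 flag) ⟩
    16 * (∑[ L ∈ tuples 4 ] flag L) + (∑[ L ∈ tuples 4 ] baseline (distinctCount L)) ∎
    where open ≤-Reasoning

  -- The pairs (r, r) agree in all 13 columns, where the quartic bound has slack 2116 = 46².
  diagonal : Fin 48 × Fin 48 → ℕ
  diagonal (r , r') = ⟦ isYes (r Fin.≟ r') ⟧

  diagonals : ∑[ rr ∈ rowPairs ] diagonal rr ≡ 48
  diagonals = refl

  pair-bound : ∀ rr → 24 * agreement rr ^ 3 + 792 * agreement rr ^ 1 + 2116 * diagonal rr ≤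
                      1 * agreement rr ^ 4 + 210 * agreement rr ^ 2 + 1089 * agreement rr ^ 0
  pair-bound (r , r') = by-diagonal (r Fin.≟ r')
    where
    by-diagonal : (d : Dec (r ≡ r')) →
      24 * agreement (r , r') ^ 3 + 792 * agreement (r , r') ^ 1 + 2116 * ⟦ isYes d ⟧ ≤
      1 * agreement (r , r') ^ 4 + 210 * agreement (r , r') ^ 2 + 1089 * agreement (r , r') ^ 0
    by-diagonal (yes refl) = subst (λ x → 24 * x ^ 3 + 792 * x ^ 1 + 2116 * 1 ≤ 1 * x ^ 4 + 210 * x ^ 2 + 1089 * x ^ 0)
                                   (sym (agreement-diag r)) ≤-refl
    by-diagonal (no _) = ≤-trans (≤-reflexive (+-identityʳ _)) (quartic-bound (agreement (r , r')))

  summed : 24 * moment 3 + 792 * moment 1 + 2116 * (∑[ rr ∈ rowPairs ] diagonal rr) ≤ 1 * moment 4 + 210 * moment 2 + 1089 * moment 0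
  summed = subst₂ _≤_ (∑-linear rowPairs 24 792 2116 (λ rr → agreement rr ^ 3) (λ rr → agreement rr ^ 1) diagonal)
    (∑-linear rowPairs 1 210 1089 (λ rr → agreement rr ^ 4) (λ rr → agreement rr ^ 2) (λ rr → agreement rr ^ 0))
    (∑-mono rowPairs (λ {rr} _ → pair-bound rr))

theorem5p9 : ¬ (Σ (Matrix 48 13) (IsCoveringArray 5 48 13))
theorem5p9 (A , covering) =
  incompatible-moments
    (moment-exact 0 z≤n baselines-0)
    (moment-exact 1 (s≤s z≤n) baselines-1)
    (moment-exact 2 (s≤s (s≤s z≤n)) baselines-2)
    (moment-exact 3 (s≤s (s≤s (s≤s z≤n))) baselines-3)
    baselines-4 diagonals flags-bound moment-4 summed
  where open Thirteen A covering
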